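{- Let $\Omega'$ be the set of wide triangular partitions with at least two parts. For $\tau=\tau_1\dots\tau_k\in\Omega'$ let $\min(\tau)=\tau_k$, $\operatorname{dif}(\tau)=\min\{\tau_i-\tau_{i+1}:1\le i\le k-1\}$, and $\operatorname{wrd}(\tau)=w_1\dots w_{k-1}$ with $w_i=\tau_i-\tau_{i+1}-\operatorname{dif}(\tau)$ (these lie in $\{0,1\}$). Then the map $\chi=(\min,\operatorname{dif},\operatorname{wrd})$ is a bijection from $\Omega'$ to $$\mathcal{T}=\{(m,d,w)\in\mathbb{N}\times\mathbb{N}\times\mathcal{B}^0 : m\le d+1,\ \text{and } w1\in\mathcal{B}^0 \text{ if } m=d+1\},$$ with inverse $\xi(m,d,w_1\dots w_{k-1})=\tau_1\dots\tau_k$ where $\tau_i=m+\sum_{j=i}^{k-1}(w_j+d)$ for $1\le i\le k$. Moreover, if $\chi(\tau)=(m,d,w)$ with $w=w_1\dots w_{k-1}$, then $\tau$ has $k$ parts (the length of $w$ plus one) and $$|\tau|=km+\binom{k}{2}d+\sum_{i=1}^{k-1}iw_i.$$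
   Context: $\mathbb{N}$ denotes the positive integers. A partition $\tau=\tau_1\dots\tau_k$ is identified with its Ferrers diagram $\{(a,b)\in\mathbb{N}^2:1\le b\le k,\,1\le a\le\tau_b\}$, and $|\tau|=\sum\tau_i$. For $r,s>0$, $\mathsf{L}_{r,s}$ is the line $x/r+y/s=1$; it is a cutting line for $\tau$ if $\tau$ is exactly the set of points of $\mathbb{N}^2$ on or below it; $\tau$ is triangular if it has a cutting line, and wide if it has a cutting line with $r>s$. A finite binary word $w=w_1\dots w_\ell$ is balanced if for all $h\le\ell$ and all $i,j\le \ell-h+1$, $\left|\sum_{t=i}^{i+h-1}w_t-\sum_{t=j}^{j+h-1}w_t\right|\le1$. $\mathcal{B}^0$ is the set of balanced binary words containing at least one $0$, and $w1$ denotes $w$ with the letter $1$ appended.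
   Formalization: The parameters r and s of the cutting lines $\mathsf{L}_{r,s}$ range over the positive rationals instead of the positive real numbers. -}

module Defs where

open import Data.Nat using (ℕ; zero; suc; _+_; _*_; _∸_; _≤_; _<_; _⊓_; ∣_-_∣)
open import Data.Nat.ListAction using (sum)
open import Data.List using (List; []; _∷_; _++_; length; map; take; drop; upTo; zipWith)
open import Data.List.Membership.Propositional using (_∈_)
open import Data.List.Relation.Unary.All using (All)
open import Data.List.Relation.Unary.Linked using (Linked)
open import Data.Product using (Σ; _×_; _,_; ∃; ∃-syntax)
open import Relation.Binary.PropositionalEquality using (_≡_)
open import Data.Integer using (+_)
open import Data.Rational as ℚ using (ℚ; 0ℚ; 1ℚ; _÷_; positive)
open import Data.Rational.Properties using (pos⇒nonZero)
open import Function.Bundles using (_⇔_)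

IsPartition : List ℕ → Set
IsPartition τ = All (1 ≤_) τ × Linked (λ x y → y ≤ x) τ

-- 1-based part τ_b (0 outside the range 1 ≤ b ≤ k; only used in range)
part : List ℕ → ℕ → ℕ
part []       _             = 0
part (x ∷ xs) zero          = 0
part (x ∷ xs) (suc zero)    = x
part (x ∷ xs) (suc (suc b)) = part xs (suc b)

InDiagram : List ℕ → ℕ → ℕ → Set
InDiagram τ a b = (1 ≤ b) × (b ≤ length τ) × (1 ≤ a) × (a ≤ part τ b)

ℕ→ℚ : ℕ → ℚ
ℕ→ℚ n = + n ℚ./ 1

lineVal : (r s : ℚ) → r ℚ.> 0ℚ → s ℚ.> 0ℚ → ℕ → ℕ → ℚ
lineVal r s r>0 s>0 x y =
  (ℕ→ℚ x ÷ r) {{pos⇒nonZero r {{positive r>0}}}}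
    ℚ.+ (ℕ→ℚ y ÷ s) {{pos⇒nonZero s {{positive s>0}}}}

IsCuttingLine : ℚ → ℚ → List ℕ → Set
IsCuttingLine r s τ =
  Σ (r ℚ.> 0ℚ) λ r>0 → Σ (s ℚ.> 0ℚ) λ s>0 →
    ∀ (a b : ℕ) → 1 ≤ a → 1 ≤ b →
      InDiagram τ a b ⇔ (lineVal r s r>0 s>0 a b ℚ.≤ 1ℚ)

Triangular : List ℕ → Set
Triangular τ = ∃[ r ] ∃[ s ] IsCuttingLine r s τ

Wide : List ℕ → Set
Wide τ = ∃[ r ] ∃[ s ] (IsCuttingLine r s τ × s ℚ.< r)

InΩ' : List ℕ → Set
InΩ' τ = IsPartition τ × Triangular τ × Wide τ × 2 ≤ length τ

Binary : List ℕ → Set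
Binary w = All (_≤ 1) w

-- sum of the factor of length h starting at (0-based) position i
window : List ℕ → ℕ → ℕ → ℕ
window w i h = sum (take h (drop i w))

Balanced : List ℕ → Set
Balanced w = ∀ (h i j : ℕ) → h ≤ length w → i + h ≤ length w → j + h ≤ length w →
  ∣ window w i h - window w j h ∣ ≤ 1

InB⁰ : List ℕ → Set
InB⁰ w = Binary w × Balanced w × (0 ∈ w)

_·1 : List ℕ → List ℕ
w ·1 = w ++ (1 ∷ [])

Triple : Set
Triple = ℕ × ℕ × List ℕ

InT : Triple → Set
InT (m , d , w) =
  (1 ≤ m) × (1 ≤ d) × InB⁰ w × (m ≤ d + 1) × (m ≡ d + 1 → InB⁰ (w ·1))

minPart : List ℕ → ℕ
minPart []           = 0
minPart (x ∷ [])     = x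
minPart (x ∷ y ∷ xs) = minPart (y ∷ xs)

diffs : List ℕ → List ℕ
diffs (x ∷ y ∷ xs) = (x ∸ y) ∷ diffs (y ∷ xs)
diffs _            = []

-- minimum of a nonempty list (0 on the empty list; unused there)
minList : List ℕ → ℕ
minList []           = 0
minList (x ∷ [])     = x
minList (x ∷ y ∷ xs) = x ⊓ minList (y ∷ xs)

dif : List ℕ → ℕ
dif τ = minList (diffs τ)

wrd : List ℕ → List ℕ
wrd τ = map (λ δ → δ ∸ dif τ) (diffs τ)

χ : List ℕ → Triple
χ τ = minPart τ , dif τ , wrd τ

-- ξ(m,d,w₁…w_{k-1}) = τ₁…τ_k with τ_i = m + Σ_{j=i}^{k-1} (w_j + d)
-- (0-based: entry i is m + sum of (w_j + d) over drop i w, i < k)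
ξ : Triple → List ℕ
ξ (m , d , w) = map (λ i → m + sum (map (λ x → x + d) (drop i w))) (upTo (length w + 1))

size : List ℕ → ℕ
size τ = sum τ

weightedSum : List ℕ → ℕ
weightedSum w = sum (zipWith _*_ (map suc (upTo (length w))) w)

-- After clearing denominators a cutting line of τ becomes a A + b B ≤ N: the cell (a , b) lies in τ
-- iff a A + b B ≤ N, and the line is wide iff A < B.  So τ_b = ⌊(N − b B) / A⌋, and any h consecutive
-- differences τ_i − τ_{i+h} sum to a value strictly between h B / A − 1 and h B / A + 1.  Writing the
-- differences as dif τ + w_j, this makes wrd τ balanced, forces dif τ ≥ 1, bounds min τ by dif τ + 1
-- and, when the bound is attained, keeps w1 balanced.  Conversely, for a triple in T every window
-- yields a lower and an upper bound on the slope B / A; balancedness puts each lower bound below each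
-- upper bound, so for A large enough some B fits them all, and N is the largest a A + b B over the
-- last cells of the rows.  The rest is bookkeeping: ξ rebuilds τ from its last part and differences.

module Submission where

open import Defs
open import Data.Nat using (ℕ; zero; suc; _+_; _*_; _∸_; _≤_; _<_; _⊓_; z≤n; s≤s; s≤s⁻¹; ∣_-_∣; _≤?_; _/_; _%_; NonZero)
open import Data.Nat.Properties
open import Data.Nat.DivMod using (m≡m%n+[m/n]*n; m%n<n; m/n*n≤m)
open import Data.Nat.ListAction using (sum)
open import Data.Nat.ListAction.Properties using (sum-++)
open import Data.Nat.Combinatorics using (_C_; nCk+nC[k+1]≡[n+1]C[k+1]; nC1≡n)
open import Data.Nat.Tactic.RingSolver using (solve-∀)
open import Data.Integer as ℤ using (+_; +[1+_]; -[1+_]; +≤+; +<+)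
import Data.Integer.Properties as ℤ
open import Data.Rational as ℚ using (ℚ; mkℚ; toℚᵘ; fromℚᵘ; 1ℚ; 0ℚ; *<*)
import Data.Rational.Properties as ℚ
open import Data.Rational.Unnormalised as ℚᵘ using (ℚᵘ; mkℚᵘ; *≤*; _≃_)
import Data.Rational.Unnormalised.Properties as ℚᵘ
open import Data.List using (List; []; _∷_; _++_; length; map; take; drop; upTo; applyUpTo; zipWith; concatMap)
open import Data.List.Properties using (map-applyUpTo; ∷-injectiveˡ; take-[]; drop-drop; drop-all; length-drop; length-++)
open import Data.List.Extrema.Nat using (argmax; argmax-sel; argmax-all; f[xs]≤f[argmax])
open import Data.List.Membership.Propositional using (_∈_; find; lose)
open import Data.List.Membership.Propositional.Properties
  using (∈-map⁺; ∈-map⁻; ∈-concatMap⁺; ∈-concatMap⁻; ∈-++⁺ˡ; ∈-++⁺ʳ; ∈-++⁻; ∈-upTo⁺; ∈-upTo⁻)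
open import Data.List.Relation.Unary.Any using (here; there)
open import Data.List.Relation.Unary.All using (All; []; _∷_)
import Data.List.Relation.Unary.All as All
open import Data.List.Relation.Unary.All.Properties using (++⁺)
open import Data.List.Relation.Unary.Linked using (Linked; [-]; _∷_)
open import Data.Product using (∃-syntax; _×_; _,_; proj₁; proj₂)
open import Data.Sum using (_⊎_; inj₁; inj₂)
open import Data.Empty using (⊥-elim)
open import Relation.Nullary using (¬_; yes; no)
open import Relation.Binary using (tri<; tri≈; tri>)
open import Function.Base using (id)
open import Function.Bundles using (_⇔_; mk⇔; Equivalence)
open import Function.Construct.Composition using (_⇔-∘_)
open import Function.Construct.Symmetry using (⇔-sym)
open import Relation.Binary.PropositionalEquality
  using (_≡_; refl; sym; trans; cong; cong₂; subst; subst₂; module ≡-Reasoning)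

shiftedSum : ℕ → List ℕ → ℕ
shiftedSum d l = sum (map (_+ d) l)

-- ξ-part m d w i is the part τ_{i+1} of ξ (m , d , w); ξ′ computes ξ by recursion on w.
ξ-part : ℕ → ℕ → List ℕ → ℕ → ℕ
ξ-part m d w i = m + shiftedSum d (drop i w)

ξ′ : ℕ → ℕ → List ℕ → List ℕ
ξ′ m d []      = ξ-part m d [] 0 ∷ []
ξ′ m d (x ∷ w) = ξ-part m d (x ∷ w) 0 ∷ ξ′ m d w

ξ≡ξ′ : ∀ m d w → ξ (m , d , w) ≡ ξ′ m d w
ξ≡ξ′ m d w = trans (map-applyUpTo id (ξ-part m d w) (length w + 1)) (applyUpTo≡ξ′ w)
  where
  applyUpTo≡ξ′ : ∀ w → applyUpTo (ξ-part m d w) (length w + 1) ≡ ξ′ m d w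
  applyUpTo≡ξ′ []      = refl
  applyUpTo≡ξ′ (x ∷ w) = cong (ξ-part m d (x ∷ w) 0 ∷_) (applyUpTo≡ξ′ w)

length-ξ′ : ∀ m d w → length (ξ′ m d w) ≡ length w + 1
length-ξ′ m d []      = refl
length-ξ′ m d (x ∷ w) = cong suc (length-ξ′ m d w)

ξ-part-∷ : ∀ m d x w → ξ-part m d (x ∷ w) 0 ≡ x + d + ξ-part m d w 0
ξ-part-∷ m d x w = e m (x + d) (shiftedSum d w)
  where e : ∀ a b c → a + (b + c) ≡ b + (a + c)
        e = solve-∀

ξ-part-≤-∷ : ∀ m d x w → ξ-part m d w 0 ≤ ξ-part m d (x ∷ w) 0
ξ-part-≤-∷ m d x w = subst (ξ-part m d w 0 ≤_) (sym (ξ-part-∷ m d x w)) (m≤n+m _ (x + d))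

ξ′-head : ∀ {m d w y r} → ξ′ m d w ≡ y ∷ r → ξ-part m d w 0 ≡ y
ξ′-head {w = []}    eq = ∷-injectiveˡ eq
ξ′-head {w = _ ∷ _} eq = ∷-injectiveˡ eq

minPart-ξ′ : ∀ m d w → minPart (ξ′ m d w) ≡ m
minPart-ξ′ m d []          = +-identityʳ m
minPart-ξ′ m d (x ∷ [])    = minPart-ξ′ m d []
minPart-ξ′ m d (x ∷ y ∷ w) = minPart-ξ′ m d (y ∷ w)

ξ-part-∷-∸ : ∀ m d x w → ξ-part m d (x ∷ w) 0 ∸ ξ-part m d w 0 ≡ x + d
ξ-part-∷-∸ m d x w = trans (cong (_∸ ξ-part m d w 0) (ξ-part-∷ m d x w)) (m+n∸n≡m (x + d) (ξ-part m d w 0))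

diffs-ξ′ : ∀ m d w → diffs (ξ′ m d w) ≡ map (_+ d) w
diffs-ξ′ m d []          = refl
diffs-ξ′ m d (x ∷ [])    = cong (_∷ []) (ξ-part-∷-∸ m d x [])
diffs-ξ′ m d (x ∷ y ∷ w) = cong₂ _∷_ (ξ-part-∷-∸ m d x (y ∷ w)) (diffs-ξ′ m d (y ∷ w))

minList-≤ : ∀ {x} l → x ∈ l → minList l ≤ x
minList-≤ (x ∷ [])    (here refl) = ≤-refl
minList-≤ (x ∷ y ∷ l) (here refl) = m⊓n≤m x _
minList-≤ (x ∷ y ∷ l) (there p)   = ≤-trans (m⊓n≤n x _) (minList-≤ (y ∷ l) p)

minList-∈ : ∀ x l → minList (x ∷ l) ∈ x ∷ l
minList-∈ x []      = here refl
minList-∈ x (y ∷ l) = select (⊓-sel x (minList (y ∷ l))) (minList-∈ y l)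
  where
  select : (x ⊓ minList (y ∷ l) ≡ x) ⊎ (x ⊓ minList (y ∷ l) ≡ minList (y ∷ l)) →
           minList (y ∷ l) ∈ y ∷ l → x ⊓ minList (y ∷ l) ∈ x ∷ y ∷ l
  select (inj₁ eq) _  = here eq
  select (inj₂ eq) ih = there (subst (_∈ y ∷ l) (sym eq) ih)

minList-map-+ : ∀ d x l → minList (map (_+ d) (x ∷ l)) ≡ minList (x ∷ l) + d
minList-map-+ d x []      = refl
minList-map-+ d x (y ∷ l) = trans (cong ((x + d) ⊓_) (minList-map-+ d y l)) (sym (+-distribʳ-⊓ d x _))

map-∸-+ : ∀ d w → map (_∸ d) (map (_+ d) w) ≡ w
map-∸-+ d []      = refl
map-∸-+ d (x ∷ w) = cong₂ _∷_ (m+n∸n≡m x d) (map-∸-+ d w)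

dif-ξ′ : ∀ m d w → 0 ∈ w → dif (ξ′ m d w) ≡ d
dif-ξ′ m d w@(x ∷ w′) 0∈w = begin
  minList (diffs (ξ′ m d w))  ≡⟨ cong minList (diffs-ξ′ m d w) ⟩
  minList (map (_+ d) w)      ≡⟨ minList-map-+ d x w′ ⟩
  minList w + d               ≡⟨ cong (_+ d) (n≤0⇒n≡0 (minList-≤ w 0∈w)) ⟩
  d                           ∎
  where open ≡-Reasoning

χ-ξ′ : ∀ m d w → 0 ∈ w → χ (ξ′ m d w) ≡ (m , d , w)
χ-ξ′ m d w 0∈w = cong₂ _,_ (minPart-ξ′ m d w) (cong₂ _,_ (dif-ξ′ m d w 0∈w) (begin
  map (_∸ dif (ξ′ m d w)) (diffs (ξ′ m d w)) ≡⟨ cong (λ e → map (_∸ e) (diffs (ξ′ m d w))) (dif-ξ′ m d w 0∈w) ⟩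
  map (_∸ d) (diffs (ξ′ m d w))              ≡⟨ cong (map (_∸ d)) (diffs-ξ′ m d w) ⟩
  map (_∸ d) (map (_+ d) w)                  ≡⟨ map-∸-+ d w ⟩
  w                                          ∎))
  where open ≡-Reasoning

Decreasing : List ℕ → Set
Decreasing = Linked (λ x y → y ≤ x)

ξ′-reconstructs : ∀ d x τ → Decreasing (x ∷ τ) → All (d ≤_) (diffs (x ∷ τ)) →
                  ξ′ (minPart (x ∷ τ)) d (map (_∸ d) (diffs (x ∷ τ))) ≡ x ∷ τ
ξ′-reconstructs d x []      _ _ = cong (_∷ []) (+-identityʳ x)
ξ′-reconstructs d x (y ∷ τ) (y≤x ∷ dec) (d≤x∸y ∷ d≤) = cong₂ _∷_ top rest
  where
  open ≡-Reasoning
  m = minPart (y ∷ τ)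
  W = map (_∸ d) (diffs (y ∷ τ))
  rest : ξ′ m d W ≡ y ∷ τ
  rest = ξ′-reconstructs d y τ dec d≤
  top : ξ-part m d (x ∸ y ∸ d ∷ W) 0 ≡ x
  top = begin
    ξ-part m d (x ∸ y ∸ d ∷ W) 0  ≡⟨ ξ-part-∷ m d (x ∸ y ∸ d) W ⟩
    x ∸ y ∸ d + d + ξ-part m d W 0 ≡⟨ cong₂ _+_ (m∸n+n≡m d≤x∸y) (ξ′-head rest) ⟩
    x ∸ y + y                      ≡⟨ m∸n+n≡m y≤x ⟩
    x                              ∎

dif≤diffs : ∀ τ → All (dif τ ≤_) (diffs τ)
dif≤diffs τ = All.tabulate (minList-≤ (diffs τ))

ξ′-χ : ∀ τ → IsPartition τ → 2 ≤ length τ → ξ′ (minPart τ) (dif τ) (wrd τ) ≡ τ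
ξ′-χ τ@(x ∷ τ′) (_ , dec) _ = ξ′-reconstructs (dif τ) x τ′ dec (dif≤diffs τ)

shiftedSum≡ : ∀ d l → shiftedSum d l ≡ sum l + length l * d
shiftedSum≡ d []      = refl
shiftedSum≡ d (x ∷ l) = trans (cong (_+_ (x + d)) (shiftedSum≡ d l)) (e x d (sum l) (length l * d))
  where e : ∀ x d s t → x + d + (s + t) ≡ x + s + (d + t)
        e = solve-∀

sum-zipWith-applyUpTo-suc : ∀ f w → sum (zipWith _*_ (applyUpTo (λ i → suc (f i)) (length w)) w)
                                    ≡ sum w + sum (zipWith _*_ (applyUpTo f (length w)) w)
sum-zipWith-applyUpTo-suc f []      = refl
sum-zipWith-applyUpTo-suc f (x ∷ w) =
  trans (cong (_+_ (x + f 0 * x)) (sum-zipWith-applyUpTo-suc (λ i → f (suc i)) w)) (e x (f 0 * x) (sum w) _)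
  where e : ∀ a b s t → a + b + (s + t) ≡ a + s + (b + t)
        e = solve-∀

weightedSum-∷ : ∀ x w → weightedSum (x ∷ w) ≡ x + sum w + weightedSum w
weightedSum-∷ x w = begin
  weightedSum (x ∷ w)                      ≡⟨ cong (λ ws → sum (zipWith _*_ ws (x ∷ w))) (map-applyUpTo id suc (suc n)) ⟩
  x + 0 + weighted (λ i → suc (suc i))     ≡⟨ cong₂ _+_ (+-identityʳ x) (sum-zipWith-applyUpTo-suc suc w) ⟩
  x + (sum w + weighted suc)               ≡⟨ +-assoc x (sum w) _ ⟨
  x + sum w + weighted suc                 ≡⟨ cong (λ ws → x + sum w + sum (zipWith _*_ ws w)) (map-applyUpTo id suc n) ⟨
  x + sum w + weightedSum w                ∎
  where
  open ≡-Reasoning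
  n = length w
  weighted : (ℕ → ℕ) → ℕ
  weighted f = sum (zipWith _*_ (applyUpTo f n) w)

[1+n]C2 : ∀ n → suc n C 2 ≡ n C 2 + n
[1+n]C2 n = trans (sym (nCk+nC[k+1]≡[n+1]C[k+1] n 1)) (trans (+-comm (n C 1) (n C 2)) (cong (_+_ (n C 2)) (nC1≡n n)))

size-ξ′ : ∀ m d w → let k = length w + 1 in size (ξ′ m d w) ≡ k * m + (k C 2) * d + weightedSum w
size-ξ′ m d []      = e m d
  where e : ∀ m d → m + 0 + 0 ≡ 1 * m + 0 * d + 0
        e = solve-∀
size-ξ′ m d (x ∷ w) = begin
  ξ-part m d (x ∷ w) 0 + size (ξ′ m d w)
    ≡⟨ cong₂ (λ s t → m + (x + d + s) + t) (shiftedSum≡ d w) (size-ξ′ m d w) ⟩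
  m + (x + d + (sum w + n * d)) + ((n + 1) * m + ((n + 1) C 2) * d + weightedSum w)
    ≡⟨ e m x d (sum w) n ((n + 1) C 2) (weightedSum w) ⟩
  (suc n + 1) * m + ((n + 1) C 2 + (n + 1)) * d + (x + sum w + weightedSum w)
    ≡⟨ cong₂ (λ c s → (suc n + 1) * m + c * d + s) (sym ([1+n]C2 (n + 1))) (sym (weightedSum-∷ x w)) ⟩
  (suc n + 1) * m + ((suc n + 1) C 2) * d + weightedSum (x ∷ w) ∎
  where
  open ≡-Reasoning
  n = length w
  e : ∀ m x d s n c W → m + (x + d + (s + n * d)) + ((n + 1) * m + c * d + W)
        ≡ (suc n + 1) * m + (c + (n + 1)) * d + (x + s + W)
  e = solve-∀

-- The cutting line L_{r,s} with denominators cleared: r = N/A and s = N/B, so wide means A < B.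
IntegerCut : ℕ → ℕ → ℕ → List ℕ → Set
IntegerCut A B N τ = ∀ a b → 1 ≤ a → 1 ≤ b → InDiagram τ a b ⇔ (a * A + b * B ≤ N)

-- lineVal at r = (n₁+1)/(d₁+1) and s = (n₂+1)/(d₂+1), computed without normalisation
lineValᵘ : ℕ → ℕ → ℕ → ℕ → ℕ → ℕ → ℚᵘ
lineValᵘ n₁ d₁ n₂ d₂ a b = mkℚᵘ (+ a) 0 ℚᵘ.* mkℚᵘ +[1+ d₁ ] n₁ ℚᵘ.+ mkℚᵘ (+ b) 0 ℚᵘ.* mkℚᵘ +[1+ d₂ ] n₂

lineValᵘ≤1⇔ : ∀ n₁ d₁ n₂ d₂ a b →
  (lineValᵘ n₁ d₁ n₂ d₂ a b ℚᵘ.≤ ℚᵘ.1ℚᵘ) ⇔ (a * suc d₁ * suc n₂ + b * suc d₂ * suc n₁ ≤ suc n₁ * suc n₂)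
lineValᵘ≤1⇔ n₁ d₁ n₂ d₂ a b = mk⇔
  (λ { (*≤* p) → ℤ.drop‿+≤+ (subst₂ ℤ._≤_ numerator≡ denominator≡ p) })
  (λ p → *≤* (subst₂ ℤ._≤_ (sym numerator≡) (sym denominator≡) (+≤+ p)))
  where
  term : ∀ a d n → (+ a ℤ.* +[1+ d ]) ℤ.* + suc (n + 0) ≡ + (a * suc d * suc n)
  term a d n = begin
    (+ a ℤ.* +[1+ d ]) ℤ.* + suc (n + 0) ≡⟨ cong (λ k → (+ a ℤ.* +[1+ d ]) ℤ.* + suc k) (+-identityʳ n) ⟩
    (+ a ℤ.* + suc d) ℤ.* + suc n      ≡⟨ cong (ℤ._* + suc n) (ℤ.pos-* a (suc d)) ⟨
    + (a * suc d) ℤ.* + suc n           ≡⟨ ℤ.pos-* (a * suc d) (suc n) ⟨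
    + (a * suc d * suc n)               ∎
    where open ≡-Reasoning
  numerator≡ : ℚᵘ.↥ lineValᵘ n₁ d₁ n₂ d₂ a b ℤ.* + 1 ≡ + (a * suc d₁ * suc n₂ + b * suc d₂ * suc n₁)
  numerator≡ = trans (ℤ.*-identityʳ _)
    (trans (cong₂ ℤ._+_ (term a d₁ n₂) (term b d₂ n₁)) (sym (ℤ.pos-+ (a * suc d₁ * suc n₂) _)))
  denominator≡ : + 1 ℤ.* ℚᵘ.↧ lineValᵘ n₁ d₁ n₂ d₂ a b ≡ + (suc n₁ * suc n₂)
  denominator≡ = trans (ℤ.*-identityˡ _) (cong₂ (λ x y → + (suc x * suc y)) (+-identityʳ n₁) (+-identityʳ n₂))

numerator : ℚ → ℕ
numerator r = ℤ.∣ ℚ.↥ r ∣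

lineVal≤1⇔ : ∀ r s r>0 s>0 a b → (lineVal r s r>0 s>0 a b ℚ.≤ 1ℚ)
  ⇔ (a * ℚ.↧ₙ r * numerator s + b * ℚ.↧ₙ s * numerator r ≤ numerator r * numerator s)
lineVal≤1⇔ r@(mkℚ +[1+ n₁ ] d₁ _) s@(mkℚ +[1+ n₂ ] d₂ _) r>0 s>0 a b =
  lineValᵘ≤1⇔ n₁ d₁ n₂ d₂ a b ⇔-∘ mk⇔
    (λ p → ℚᵘ.≤-respˡ-≃ toℚᵘ-lineVal (ℚ.toℚᵘ-mono-≤ p))
    (λ p → ℚ.toℚᵘ-cancel-≤ (ℚᵘ.≤-respˡ-≃ (ℚᵘ.≃-sym toℚᵘ-lineVal) p))
  where
  ofℕ : ∀ x → toℚᵘ (ℕ→ℚ x) ≃ mkℚᵘ (+ x) 0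
  ofℕ x = ℚ.toℚᵘ-fromℚᵘ (mkℚᵘ (+ x) 0)
  toℚᵘ-lineVal : toℚᵘ (lineVal r s r>0 s>0 a b) ≃ lineValᵘ n₁ d₁ n₂ d₂ a b
  toℚᵘ-lineVal = ℚᵘ.≃-trans (ℚ.toℚᵘ-homo-+ (ℕ→ℚ a ℚ.* ℚ.1/ r) (ℕ→ℚ b ℚ.* ℚ.1/ s))
    (ℚᵘ.+-cong (ℚᵘ.≃-trans (ℚ.toℚᵘ-homo-* (ℕ→ℚ a) (ℚ.1/ r)) (ℚᵘ.*-cong (ofℕ a) ℚᵘ.≃-refl))
               (ℚᵘ.≃-trans (ℚ.toℚᵘ-homo-* (ℕ→ℚ b) (ℚ.1/ s)) (ℚᵘ.*-cong (ofℕ b) ℚᵘ.≃-refl)))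
lineVal≤1⇔ (mkℚ (+ zero) _ _)   _                    (*<* (+<+ ()))  _ _ _
lineVal≤1⇔ (mkℚ -[1+ _ ] _ _)   _                    (*<* ())        _ _ _
lineVal≤1⇔ (mkℚ +[1+ _ ] _ _)   (mkℚ (+ zero) _ _)   _ (*<* (+<+ ())) _ _
lineVal≤1⇔ (mkℚ +[1+ _ ] _ _)   (mkℚ -[1+ _ ] _ _)   _ (*<* ())       _ _

wide⇒integerCut : ∀ {τ} → Wide τ → ∃[ A ] ∃[ B ] ∃[ N ] 1 ≤ A × A < B × IntegerCut A B N τ
wide⇒integerCut (r@(mkℚ +[1+ n₁ ] d₁ _) , s@(mkℚ +[1+ n₂ ] d₂ _) , (r>0 , s>0 , cut) , *<* s<r) =
  suc d₁ * suc n₂ , suc d₂ * suc n₁ , suc n₁ * suc n₂ , s≤s z≤n ,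
  subst₂ _<_ (*-comm (suc n₂) (suc d₁)) (*-comm (suc n₁) (suc d₂)) (ℤ.drop‿+<+ s<r) ,
  λ a b 1≤a 1≤b → reassociate a b ⇔-∘ (lineVal≤1⇔ r s r>0 s>0 a b ⇔-∘ cut a b 1≤a 1≤b)
  where
  reassociate : ∀ a b → (a * suc d₁ * suc n₂ + b * suc d₂ * suc n₁ ≤ suc n₁ * suc n₂)
                      ⇔ (a * (suc d₁ * suc n₂) + b * (suc d₂ * suc n₁) ≤ suc n₁ * suc n₂)
  reassociate a b rewrite *-assoc a (suc d₁) (suc n₂) | *-assoc b (suc d₂) (suc n₁) = mk⇔ (λ p → p) (λ p → p)
wide⇒integerCut (_ , mkℚ (+ zero) _ _ , (_ , *<* (+<+ ()) , _) , _)
wide⇒integerCut (_ , mkℚ -[1+ _ ] _ _ , (_ , *<* () , _) , _)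
wide⇒integerCut (mkℚ (+ zero) _ _ , mkℚ +[1+ _ ] _ _ , (*<* (+<+ ()) , _) , _)
wide⇒integerCut (mkℚ -[1+ _ ] _ _ , mkℚ +[1+ _ ] _ _ , (*<* () , _) , _)

numerator*≡*denominator : ∀ r x y → r ℚ.> 0ℚ → toℚᵘ r ≃ mkℚᵘ (+ x) y → numerator r * suc y ≡ x * ℚ.↧ₙ r
numerator*≡*denominator (mkℚ +[1+ n ] d _) x y _ (ℚᵘ.*≡* eq) =
  ℤ.+-injective (trans (ℤ.pos-* (suc n) (suc y)) (trans eq (sym (ℤ.pos-* x (suc d)))))
numerator*≡*denominator (mkℚ (+ zero) _ _) _ _ (*<* (+<+ ())) _
numerator*≡*denominator (mkℚ -[1+ _ ] _ _) _ _ (*<* ())        _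

-- For r = N/A = Nr/Dr and s = N/B = Ns/Ds, multiplying by A B turns the cross-multiplied line
-- inequality into N Dr Ds (a A + b B) ≤ N Dr Ds N.
scaled≤⇔ : ∀ a b A B N Dr Ds Nr Ns .{{_ : NonZero (N * Dr * Ds)}} .{{_ : NonZero (A * B)}} →
  Nr * A ≡ N * Dr → Ns * B ≡ N * Ds →
  (a * Dr * Ns + b * Ds * Nr ≤ Nr * Ns) ⇔ (a * A + b * B ≤ N)
scaled≤⇔ a b A B N Dr Ds Nr Ns r≡ s≡ = mk⇔
  (λ p → *-cancelˡ-≤ (N * Dr * Ds) (subst₂ _≤_ lhs rhs (*-monoˡ-≤ (A * B) p)))
  (λ p → *-cancelʳ-≤ _ _ (A * B) (subst₂ _≤_ (sym lhs) (sym rhs) (*-monoʳ-≤ (N * Dr * Ds) p)))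
  where
  open ≡-Reasoning
  lhs : (a * Dr * Ns + b * Ds * Nr) * (A * B) ≡ N * Dr * Ds * (a * A + b * B)
  lhs = begin
    (a * Dr * Ns + b * Ds * Nr) * (A * B)        ≡⟨ e₁ a b A B Dr Ds Nr Ns ⟩
    a * Dr * (Ns * B) * A + b * Ds * (Nr * A) * B ≡⟨ cong₂ (λ u v → a * Dr * u * A + b * Ds * v * B) s≡ r≡ ⟩
    a * Dr * (N * Ds) * A + b * Ds * (N * Dr) * B ≡⟨ e₂ a b A B N Dr Ds ⟩
    N * Dr * Ds * (a * A + b * B)                ∎
    where
    e₁ : ∀ a b A B Dr Ds Nr Ns → (a * Dr * Ns + b * Ds * Nr) * (A * B) ≡ a * Dr * (Ns * B) * A + b * Ds * (Nr * A) * B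
    e₁ = solve-∀
    e₂ : ∀ a b A B N Dr Ds → a * Dr * (N * Ds) * A + b * Ds * (N * Dr) * B ≡ N * Dr * Ds * (a * A + b * B)
    e₂ = solve-∀
  rhs : Nr * Ns * (A * B) ≡ N * Dr * Ds * N
  rhs = begin
    Nr * Ns * (A * B)     ≡⟨ e₁ A B Nr Ns ⟩
    (Nr * A) * (Ns * B)   ≡⟨ cong₂ _*_ r≡ s≡ ⟩
    (N * Dr) * (N * Ds)   ≡⟨ e₂ N Dr Ds ⟩
    N * Dr * Ds * N       ∎
    where
    e₁ : ∀ A B Nr Ns → Nr * Ns * (A * B) ≡ (Nr * A) * (Ns * B)
    e₁ = solve-∀
    e₂ : ∀ N Dr Ds → (N * Dr) * (N * Ds) ≡ N * Dr * Ds * N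
    e₂ = solve-∀

integerCut⇒wide : ∀ {τ A B N} → 1 ≤ A → A < B → 1 ≤ N → IntegerCut A B N τ → Wide τ
integerCut⇒wide {τ} {suc A′} {suc B′} {suc N′} _ A<B _ cut = r , s , (r>0 , s>0 , onLine) , s<r
  where
  N = suc N′
  r = fromℚᵘ (mkℚᵘ (+ N) A′)
  s = fromℚᵘ (mkℚᵘ (+ N) B′)
  r≃ : toℚᵘ r ≃ mkℚᵘ (+ N) A′
  r≃ = ℚ.toℚᵘ-fromℚᵘ _
  s≃ : toℚᵘ s ≃ mkℚᵘ (+ N) B′
  s≃ = ℚ.toℚᵘ-fromℚᵘ _
  r>0 : r ℚ.> 0ℚ
  r>0 = ℚ.toℚᵘ-cancel-< (ℚᵘ.<-respʳ-≃ (ℚᵘ.≃-sym r≃) (ℚᵘ.*<* (+<+ (s≤s z≤n))))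
  s>0 : s ℚ.> 0ℚ
  s>0 = ℚ.toℚᵘ-cancel-< (ℚᵘ.<-respʳ-≃ (ℚᵘ.≃-sym s≃) (ℚᵘ.*<* (+<+ (s≤s z≤n))))
  s<r : s ℚ.< r
  s<r = ℚ.toℚᵘ-cancel-< (ℚᵘ.<-respˡ-≃ (ℚᵘ.≃-sym s≃) (ℚᵘ.<-respʳ-≃ (ℚᵘ.≃-sym r≃)
    (ℚᵘ.*<* (subst₂ ℤ._<_ (ℤ.pos-* N (suc A′)) (ℤ.pos-* N (suc B′)) (+<+ (*-monoʳ-< N A<B))))))
  onLine : ∀ a b → 1 ≤ a → 1 ≤ b → InDiagram τ a b ⇔ (lineVal r s r>0 s>0 a b ℚ.≤ 1ℚ)
  onLine a b 1≤a 1≤b = ⇔-sym (scaled≤⇔ a b (suc A′) (suc B′) N (ℚ.↧ₙ r) (ℚ.↧ₙ s) (numerator r) (numerator s)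
      (numerator*≡*denominator r N A′ r>0 r≃) (numerator*≡*denominator s N B′ s>0 s≃)
    ⇔-∘ lineVal≤1⇔ r s r>0 s>0 a b) ⇔-∘ cut a b 1≤a 1≤b

take-+ : ∀ a b (l : List ℕ) → take (a + b) l ≡ take a l ++ take b (drop a l)
take-+ zero    b l       = refl
take-+ (suc a) b []      = sym (take-[] b)
take-+ (suc a) b (x ∷ l) = cong (x ∷_) (take-+ a b l)

window-+ : ∀ w i a b → window w i (a + b) ≡ window w i a + window w (i + a) b
window-+ w i a b = begin
  sum (take (a + b) (drop i w))                          ≡⟨ cong sum (take-+ a b (drop i w)) ⟩
  sum (take a (drop i w) ++ take b (drop a (drop i w)))  ≡⟨ sum-++ (take a (drop i w)) _ ⟩
  window w i a + sum (take b (drop a (drop i w)))        ≡⟨ cong (λ l → window w i a + sum (take b l)) (drop-drop i a w) ⟩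
  window w i a + window w (i + a) b                      ∎
  where open ≡-Reasoning

window-++ : ∀ w v i h → i + h ≤ length w → window (w ++ v) i h ≡ window w i h
window-++ w v zero    zero    _       = refl
window-++ (x ∷ w) v zero (suc h) (s≤s p) = cong (_+_ x) (window-++ w v zero h p)
window-++ (x ∷ w) v (suc i) h (s≤s p) = window-++ w v i h p

window-·1 : ∀ w i h → i + h ≡ length w → window (w ·1) i (suc h) ≡ window w i h + 1
window-·1 []      zero    zero    _  = refl
window-·1 (x ∷ w) zero    (suc h) eq =
  trans (cong (_+_ x) (window-·1 w zero h (suc-injective eq))) (sym (+-assoc x _ 1))
window-·1 (x ∷ w) (suc i) h       eq = window-·1 w i h (suc-injective eq)

∈⇒window : ∀ {x} w → x ∈ w → ∃[ j ] j + 1 ≤ length w × window w j 1 ≡ x + 0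
∈⇒window (x ∷ w) (here refl) = 0 , s≤s z≤n , refl
∈⇒window (y ∷ w) (there p) with ∈⇒window w p
... | j , j<n , eq = suc j , s≤s j<n , eq

∣-∣≤1 : ∀ {a b} → a ≤ b + 1 → b ≤ a + 1 → ∣ a - b ∣ ≤ 1
∣-∣≤1 {a} {b} a≤ b≤ with ∣m-n∣≡[m∸n]∨[n∸m] a b
... | inj₁ eq = subst (_≤ 1) (sym eq) (m≤n+o⇒m∸n≤o a b a≤)
... | inj₂ eq = subst (_≤ 1) (sym eq) (m≤n+o⇒m∸n≤o b a b≤)

∣-∣≤1⇒≤+1 : ∀ a b → ∣ a - b ∣ ≤ 1 → a ≤ b + 1
∣-∣≤1⇒≤+1 a b d≤1 = ≤-trans (m≤n+∣m-n∣ a b) (+-monoʳ-≤ b d≤1)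

balanced⇒window≤ : ∀ {v} → Balanced v → ∀ i j h → i + h ≤ length v → j + h ≤ length v →
                   window v i h ≤ window v j h + 1
balanced⇒window≤ bal i j h i+h≤ j+h≤ = ∣-∣≤1⇒≤+1 _ _ (bal h i j (≤-trans (m≤n+m h i) i+h≤) i+h≤ j+h≤)

balanced⇒binary : ∀ {v} → Balanced v → 0 ∈ v → Binary v
balanced⇒binary {v} bal 0∈v = All.tabulate λ {x} x∈v →
  let (i , i<n , ≡x) = ∈⇒window v x∈v
      (j , j<n , ≡0) = ∈⇒window v 0∈v
  in subst (_≤ 1) (+-identityʳ x) (subst₂ _≤_ ≡x (cong (_+ 1) ≡0) (balanced⇒window≤ bal i j 1 i<n j<n))

-- Euclid's algorithm on the lengths (h, h′): the longer window is split into a window of the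
-- shorter length, compared directly by balancedness, and a remainder handled recursively.
balanced-cross : ∀ {v} → Balanced v → ∀ i h j h′ → 1 ≤ h′ → i + h ≤ length v → j + h′ ≤ length v →
                 h′ * window v i h < h * (window v j h′ + 1) + h′
balanced-cross     bal i zero    j h′ 1≤h′ _ _ = subst (_< h′) (sym (*-zeroʳ h′)) 1≤h′
balanced-cross {v} bal i (suc h) j h′ = go (suc h + h′) i (suc h) j h′ ≤-refl (s≤s z≤n)
  where
  shorter : ∀ {a b n} → a + b ≤ suc n → 1 ≤ b → a ≤ n
  shorter {a} {n = n} a+b≤ 1≤b = s≤s⁻¹ (subst (_≤ suc n) (+-comm a 1) (≤-trans (+-monoʳ-≤ a 1≤b) a+b≤))
  go : ∀ n i h j h′ → h + h′ ≤ n → 1 ≤ h → 1 ≤ h′ → i + h ≤ length v → j + h′ ≤ length v →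
       h′ * window v i h < h * (window v j h′ + 1) + h′
  go zero    i (suc h) j h′ () _ _ _ _
  go (suc n) i h       j h′ fuel 1≤h 1≤h′ i+h≤ j+h′≤ with <-cmp h h′
  ... | tri≈ _ refl _ =
    subst (_< h * (window v j h + 1) + h) (+-identityʳ (h * window v i h))
      (+-mono-≤-< (*-monoʳ-≤ h (balanced⇒window≤ bal i j h i+h≤ j+h′≤)) 1≤h′)
  ... | tri> _ _ h′<h = subst (λ h → h′ * window v i h < h * (s′ + 1) + h′) h′+e≡h (begin-strict
    h′ * window v i (h′ + e)                        ≡⟨ cong (h′ *_) (window-+ v i h′ e) ⟩
    h′ * (window v i h′ + window v (i + h′) e)      ≡⟨ *-distribˡ-+ h′ _ _ ⟩
    h′ * window v i h′ + h′ * window v (i + h′) e   <⟨ +-mono-≤-< direct recursive ⟩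
    h′ * (s′ + 1) + (e * (s′ + 1) + h′)             ≡⟨ e₁ h′ e s′ ⟩
    (h′ + e) * (s′ + 1) + h′                        ∎)
    where
    open ≤-Reasoning
    e = h ∸ h′
    s′ = window v j h′
    h′+e≡h : h′ + e ≡ h
    h′+e≡h = m+[n∸m]≡n (<⇒≤ h′<h)
    i+h′+e≤ : i + (h′ + e) ≤ length v
    i+h′+e≤ = subst (λ h → i + h ≤ length v) (sym h′+e≡h) i+h≤
    direct : h′ * window v i h′ ≤ h′ * (s′ + 1)
    direct = *-monoʳ-≤ h′ (balanced⇒window≤ bal i j h′ (≤-trans (+-monoʳ-≤ i (m≤m+n h′ e)) i+h′+e≤) j+h′≤)
    recursive : h′ * window v (i + h′) e < e * (s′ + 1) + h′
    recursive = go n (i + h′) e j h′ (subst (_≤ n) (trans (sym h′+e≡h) (+-comm h′ e)) (shorter fuel 1≤h′))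
      (m<n⇒0<n∸m h′<h) 1≤h′ (subst (_≤ length v) (sym (+-assoc i h′ e)) i+h′+e≤) j+h′≤
    e₁ : ∀ h′ e s′ → h′ * (s′ + 1) + (e * (s′ + 1) + h′) ≡ (h′ + e) * (s′ + 1) + h′
    e₁ = solve-∀
  ... | tri< h<h′ _ _ = subst (λ h′ → h′ * s < h * (window v j h′ + 1) + h′) h+e≡h′ (begin-strict
    (h + e) * s                               ≡⟨ *-distribʳ-+ s h e ⟩
    h * s + e * s                             <⟨ +-mono-≤-< direct recursive ⟩
    h * (b + 1) + (h * (c + 1) + e)           ≡⟨ e₁ h e b c ⟩
    h * (b + c + 1) + (h + e)                 ≡⟨ cong (λ t → h * (t + 1) + (h + e)) (window-+ v j h e) ⟨
    h * (window v j (h + e) + 1) + (h + e)    ∎)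
    where
    open ≤-Reasoning
    e = h′ ∸ h
    s = window v i h
    b = window v j h
    c = window v (j + h) e
    h+e≡h′ : h + e ≡ h′
    h+e≡h′ = m+[n∸m]≡n (<⇒≤ h<h′)
    j+h+e≤ : j + (h + e) ≤ length v
    j+h+e≤ = subst (λ h′ → j + h′ ≤ length v) (sym h+e≡h′) j+h′≤
    direct : h * s ≤ h * (b + 1)
    direct = *-monoʳ-≤ h (balanced⇒window≤ bal i j h i+h≤ (≤-trans (+-monoʳ-≤ j (m≤m+n h e)) j+h+e≤))
    recursive : e * s < h * (c + 1) + e
    recursive = go n i h (j + h) e (subst (_≤ n) (sym h+e≡h′) (shorter (subst (_≤ suc n) (+-comm h h′) fuel) 1≤h))
      1≤h (m<n⇒0<n∸m h<h′) i+h≤ (subst (_≤ length v) (sym (+-assoc j h e)) j+h+e≤)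
    e₁ : ∀ h e b c → h * (b + 1) + (h * (c + 1) + e) ≡ h * (b + c + 1) + (h + e)
    e₁ = solve-∀

BelowSlope : ℕ → ℕ → ℕ → ℕ → Set
BelowSlope A B q p = p * A < q * B + A

AboveSlope : ℕ → ℕ → ℕ → ℕ → Set
AboveSlope A B q p = q * B < (p + 1) * A

slope-sandwich : ∀ {A B q p p′} → BelowSlope A B q p → AboveSlope A B q p′ → p ≤ p′ + 1
slope-sandwich {A} {B} {q} {p} {p′} below above =
  s≤s⁻¹ (*-cancelʳ-< A p (suc (p′ + 1)) (<-trans below (subst (q * B + A <_) (e A p′) (+-monoˡ-< A above))))
  where e : ∀ A p′ → (p′ + 1) * A + A ≡ suc (p′ + 1) * A
        e = solve-∀

WindowBounds : ℕ → ℕ → ℕ → List ℕ → Set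
WindowBounds A B d v = ∀ i h → i + h ≤ length v →
  BelowSlope A B h (window v i h + h * d) × AboveSlope A B h (window v i h + h * d)

zero-slopes : ∀ {A} B → 1 ≤ A → BelowSlope A B 0 0 × AboveSlope A B 0 0
zero-slopes {A} B 1≤A =
  subst₂ _<_ (sym (*-zeroˡ A)) (sym (+-identityˡ A)) 1≤A , subst₂ _<_ (sym (*-zeroˡ B)) (sym (+-identityʳ A)) 1≤A

windowBounds⇒balanced : ∀ {A B d v} → WindowBounds A B d v → Balanced v
windowBounds⇒balanced {A} {B} {d} {v} bounds h i j _ i+h≤ j+h≤ =
  ∣-∣≤1 (window≤ i j i+h≤ j+h≤) (window≤ j i j+h≤ i+h≤)
  where
  window≤ : ∀ i j → i + h ≤ length v → j + h ≤ length v → window v i h ≤ window v j h + 1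
  window≤ i j i+h≤ j+h≤ = +-cancelʳ-≤ (h * d) (window v i h) (window v j h + 1)
    (subst (window v i h + h * d ≤_) (e (window v j h) (h * d))
      (slope-sandwich {A} {B} {h} (proj₁ (bounds i h i+h≤)) (proj₂ (bounds j h j+h≤))))
    where
    e : ∀ s t → s + t + 1 ≡ s + 1 + t
    e = solve-∀

shiftedSum-take : ∀ d h l → h ≤ length l → shiftedSum d l ≡ sum (take h l) + h * d + shiftedSum d (drop h l)
shiftedSum-take d zero    l       _       = refl
shiftedSum-take d (suc h) (x ∷ l) (s≤s p) =
  trans (cong (_+_ (x + d)) (shiftedSum-take d h l p)) (e x d (sum (take h l)) (h * d) (shiftedSum d (drop h l)))
  where e : ∀ x d s t u → x + d + (s + t + u) ≡ x + s + (d + t) + u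
        e = solve-∀

ξ-part-+ : ∀ m d w i h → i + h ≤ length w → ξ-part m d w i ≡ window w i h + h * d + ξ-part m d w (i + h)
ξ-part-+ m d w i h i+h≤ = begin
  m + shiftedSum d (drop i w)
    ≡⟨ cong (_+_ m) (shiftedSum-take d h (drop i w) h≤) ⟩
  m + (window w i h + h * d + shiftedSum d (drop h (drop i w)))
    ≡⟨ cong (λ l → m + (window w i h + h * d + shiftedSum d l)) (drop-drop i h w) ⟩
  m + (window w i h + h * d + shiftedSum d (drop (i + h) w))
    ≡⟨ e m (window w i h + h * d) _ ⟩
  window w i h + h * d + ξ-part m d w (i + h) ∎
  where
  open ≡-Reasoning
  h≤ : h ≤ length (drop i w)
  h≤ = subst (h ≤_) (sym (length-drop i w)) (m+n≤o⇒m≤o∸n h (subst (_≤ length w) (+-comm i h) i+h≤))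
  e : ∀ a b c → a + (b + c) ≡ b + (a + c)
  e = solve-∀

ξ-part-length : ∀ m d w → ξ-part m d w (length w) ≡ m + 0
ξ-part-length m d w = cong (λ l → m + shiftedSum d l) (drop-all (length w) w ≤-refl)

ξ-part-split-end : ∀ m d w i h → i + h ≡ length w → ξ-part m d w i ≡ window w i h + h * d + (m + 0)
ξ-part-split-end m d w i h i+h≡ = begin
  ξ-part m d w i                              ≡⟨ ξ-part-+ m d w i h (≤-reflexive i+h≡) ⟩
  window w i h + h * d + ξ-part m d w (i + h)  ≡⟨ cong (λ k → window w i h + h * d + ξ-part m d w k) i+h≡ ⟩
  window w i h + h * d + ξ-part m d w (length w) ≡⟨ cong (_+_ (window w i h + h * d)) (ξ-part-length m d w) ⟩
  window w i h + h * d + (m + 0)               ∎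
  where open ≡-Reasoning

part-ξ′ : ∀ m d w i → i ≤ length w → part (ξ′ m d w) (suc i) ≡ ξ-part m d w i
part-ξ′ m d []          zero    _       = refl
part-ξ′ m d (x ∷ w)     zero    _       = refl
part-ξ′ m d (x ∷ [])    (suc i) (s≤s p) = part-ξ′ m d [] i p
part-ξ′ m d (x ∷ y ∷ w) (suc i) (s≤s p) = part-ξ′ m d (y ∷ w) i p

record RowBounds (A B N m d : ℕ) (w : List ℕ) : Set where
  field
    row≤     : ∀ i → i ≤ length w → ξ-part m d w i * A + suc i * B ≤ N
    row+1>   : ∀ i → i ≤ length w → N < (ξ-part m d w i + 1) * A + suc i * B
    lastRow> : N < A + (length w + 2) * B

suc≤length-ξ′ : ∀ m d w i → i ≤ length w → suc i ≤ length (ξ′ m d w)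
suc≤length-ξ′ m d w i i≤ = subst (suc i ≤_) (trans (+-comm 1 (length w)) (sym (length-ξ′ m d w))) (s≤s i≤)

integerCut⇒rowBounds : ∀ {A B N m d w} → 1 ≤ m → IntegerCut A B N (ξ′ m d w) → RowBounds A B N m d w
integerCut⇒rowBounds {A} {B} {N} {m} {d} {w} 1≤m cut = record
  { row≤     = λ i i≤ → Equivalence.to (cut (F i) (suc i) (1≤F i) (s≤s z≤n))
                 (s≤s z≤n , suc≤length-ξ′ m d w i i≤ , 1≤F i , ≤-reflexive (sym (part-ξ′ m d w i i≤)))
  ; row+1>   = λ i i≤ → ≰⇒> λ le →
                 let (_ , _ , _ , F+1≤) = Equivalence.from (cut (F i + 1) (suc i) (≤-trans (1≤F i) (m≤m+n _ 1)) (s≤s z≤n)) le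
                 in n+1≰n (F i) (subst (F i + 1 ≤_) (part-ξ′ m d w i i≤) F+1≤)
  ; lastRow> = ≰⇒> λ le →
                 let (_ , n+2≤ , _ , _) = Equivalence.from (cut 1 (length w + 2) ≤-refl (≤-trans (s≤s z≤n) (m≤n+m 2 (length w))))
                                            (subst (λ a → a + (length w + 2) * B ≤ N) (sym (*-identityˡ A)) le)
                 in n+1≰n (length w + 1) (subst (_≤ length w + 1) (sym (+-assoc (length w) 1 1))
                      (subst (length w + 2 ≤_) (length-ξ′ m d w) n+2≤))
  }
  where
  F = ξ-part m d w
  1≤F : ∀ i → 1 ≤ F i
  1≤F i = ≤-trans 1≤m (m≤m+n m _)
  n+1≰n : ∀ n → ¬ (n + 1 ≤ n)
  n+1≰n n le = <-irrefl refl (subst (_≤ n) (+-comm n 1) le)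

rowBounds⇒integerCut : ∀ {A B N m d w} → RowBounds A B N m d w → IntegerCut A B N (ξ′ m d w)
rowBounds⇒integerCut {A} {B} {N} {m} {d} {w} bounds a (suc i) 1≤a 1≤b with i ≤? length w
... | yes i≤ = mk⇔
  (λ (_ , _ , _ , a≤) → ≤-trans (+-monoˡ-≤ (suc i * B) (*-monoˡ-≤ A (subst (a ≤_) (part-ξ′ m d w i i≤) a≤))) (row≤ i i≤))
  (λ le → 1≤b , suc≤length-ξ′ m d w i i≤ , 1≤a , subst (a ≤_) (sym (part-ξ′ m d w i i≤))
    (s≤s⁻¹ (subst (a <_) (+-comm F 1) (*-cancelʳ-< A a (F + 1)
      (+-cancelʳ-< (suc i * B) (a * A) ((F + 1) * A) (<-≤-trans (s≤s le) (row+1> i i≤)))))))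
  where
  open RowBounds bounds
  F = ξ-part m d w i
... | no i≰ = mk⇔
  (λ (_ , suc-i≤ , _ , _) → ⊥-elim (i≰ (s≤s⁻¹ (subst (suc i ≤_) (trans (length-ξ′ m d w) (+-comm (length w) 1)) suc-i≤))))
  (λ le → ⊥-elim (<⇒≱ lastRow> (≤-trans (+-mono-≤ (subst (_≤ a * A) (*-identityˡ A) (*-monoˡ-≤ A 1≤a))
                                                   (*-monoˡ-≤ B (subst (_≤ suc i) (+-comm 2 (length w)) (s≤s (≰⇒> i≰))))) le)))
  where open RowBounds bounds

rowBounds⇒windowBounds : ∀ {A B N m d w} → RowBounds A B N m d w → WindowBounds A B d w
rowBounds⇒windowBounds {A} {B} {N} {m} {d} {w} bounds i h i+h≤ = below , above
  where
  open RowBounds bounds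
  X = window w i h + h * d
  F = ξ-part m d w (i + h)
  i≤ : i ≤ length w
  i≤ = m+n≤o⇒m≤o i i+h≤
  Fᵢ≡ : ξ-part m d w i ≡ X + F
  Fᵢ≡ = ξ-part-+ m d w i h i+h≤
  below : X * A < h * B + A
  below = +-cancelˡ-< (F * A + suc i * B) (X * A) (h * B + A) (subst₂ _<_ (e₁ X F A B i) (e₂ F A B i h)
    (<-≤-trans (s≤s (subst (λ x → x * A + suc i * B ≤ N) Fᵢ≡ (row≤ i i≤))) (row+1> (i + h) i+h≤)))
    where
    e₁ : ∀ X F A B i → (X + F) * A + suc i * B ≡ (F * A + suc i * B) + X * A
    e₁ = solve-∀
    e₂ : ∀ F A B i h → (F + 1) * A + suc (i + h) * B ≡ (F * A + suc i * B) + (h * B + A)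
    e₂ = solve-∀
  above : h * B < (X + 1) * A
  above = +-cancelˡ-< (F * A + suc i * B) (h * B) ((X + 1) * A) (subst₂ _<_ (e₁ F A B i h) (e₂ X F A B i)
    (<-≤-trans (s≤s (row≤ (i + h) i+h≤)) (subst (λ x → N < (x + 1) * A + suc i * B) Fᵢ≡ (row+1> i i≤))))
    where
    e₁ : ∀ F A B i h → F * A + suc (i + h) * B ≡ (F * A + suc i * B) + h * B
    e₁ = solve-∀
    e₂ : ∀ X F A B i → (X + F + 1) * A + suc i * B ≡ (F * A + suc i * B) + (X + 1) * A
    e₂ = solve-∀

rowBounds⇒finalWindow : ∀ {A B N m d w} → RowBounds A B N m d w → ∀ i h → i + h ≡ length w →
                        BelowSlope A B (suc h) (m + window w i h + h * d)
rowBounds⇒finalWindow {A} {B} {N} {m} {d} {w} bounds i h i+h≡ =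
  +-cancelˡ-< (suc i * B) _ _ (subst₂ _<_ (e₁ (window w i h) (h * d) m A B i) (e₂ A B i h)
    (<-≤-trans (s≤s (subst (λ x → x * A + suc i * B ≤ N) (ξ-part-split-end m d w i h i+h≡) (row≤ i i≤)))
               (subst (λ n → N < A + (n + 2) * B) (sym i+h≡) lastRow>)))
  where
  open RowBounds bounds
  i≤ : i ≤ length w
  i≤ = m+n≤o⇒m≤o i (≤-reflexive i+h≡)
  e₁ : ∀ s t m A B i → (s + t + (m + 0)) * A + suc i * B ≡ suc i * B + (m + s + t) * A
  e₁ = solve-∀
  e₂ : ∀ A B i h → A + (i + h + 2) * B ≡ suc i * B + (suc h * B + A)
  e₂ = solve-∀

rowValue : ℕ → ℕ → ℕ → ℕ → List ℕ → ℕ → ℕ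
rowValue A B m d w i = ξ-part m d w i * A + suc i * B

windowBounds⇒rowBounds-at : ∀ {A B m d w} → WindowBounds A B d w →
  (∀ i h → i + h ≡ length w → BelowSlope A B (suc h) (m + window w i h + h * d)) →
  ∀ top → top ≤ length w → (∀ i → i ≤ length w → rowValue A B m d w i ≤ rowValue A B m d w top) →
  RowBounds A B (rowValue A B m d w top) m d w
windowBounds⇒rowBounds-at {A} {B} {m} {d} {w} bounds final top top≤n maximal = record
  { row≤     = maximal
  ; row+1>   = row+1>
  ; lastRow> = lastRow>
  }
  where
  n = length w
  F = ξ-part m d w
  row+1> : ∀ i → i ≤ n → rowValue A B m d w top < (F i + 1) * A + suc i * B
  row+1> i i≤ with top ≤? i
  ... | yes top≤i = subst (λ j → rowValue A B m d w top < (F j + 1) * A + suc j * B) top+h≡i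
    (subst (_< (F (top + h) + 1) * A + suc (top + h) * B) (sym (cong (λ x → x * A + suc top * B) (ξ-part-+ m d w top h top+h≤)))
      (subst₂ _<_ (sym (e₁ X (F (top + h)) A B top)) (sym (e₂ (F (top + h)) A B top h))
        (+-monoʳ-< (F (top + h) * A + suc top * B) (proj₁ (bounds top h top+h≤)))))
    where
    h = i ∸ top
    top+h≡i : top + h ≡ i
    top+h≡i = m+[n∸m]≡n top≤i
    top+h≤ : top + h ≤ n
    top+h≤ = subst (_≤ n) (sym top+h≡i) i≤
    X = window w top h + h * d
    e₁ : ∀ X F A B i → (X + F) * A + suc i * B ≡ (F * A + suc i * B) + X * A
    e₁ = solve-∀
    e₂ : ∀ F A B i h → (F + 1) * A + suc (i + h) * B ≡ (F * A + suc i * B) + (h * B + A)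
    e₂ = solve-∀
  ... | no top≰i = subst (λ j → rowValue A B m d w j < (F i + 1) * A + suc i * B) i+h≡top
    (subst ((F (i + h) * A + suc (i + h) * B) <_) (sym (cong (λ x → (x + 1) * A + suc i * B) (ξ-part-+ m d w i h i+h≤)))
      (subst₂ _<_ (sym (e₁ (F (i + h)) A B i h)) (sym (e₂ X (F (i + h)) A B i))
        (+-monoʳ-< (F (i + h) * A + suc i * B) (proj₂ (bounds i h i+h≤)))))
    where
    h = top ∸ i
    i+h≡top : i + h ≡ top
    i+h≡top = m+[n∸m]≡n (<⇒≤ (≰⇒> top≰i))
    i+h≤ : i + h ≤ n
    i+h≤ = subst (_≤ n) (sym i+h≡top) top≤n
    X = window w i h + h * d
    e₁ : ∀ F A B i h → F * A + suc (i + h) * B ≡ (F * A + suc i * B) + h * B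
    e₁ = solve-∀
    e₂ : ∀ X F A B i → (X + F + 1) * A + suc i * B ≡ (F * A + suc i * B) + (X + 1) * A
    e₂ = solve-∀
  lastRow> : rowValue A B m d w top < A + (n + 2) * B
  lastRow> = subst₂ _<_ (sym (cong (λ x → x * A + suc top * B) (ξ-part-split-end m d w top h top+h≡n)))
                        (cong (λ k → A + (k + 2) * B) top+h≡n)
    (subst₂ _<_ (sym (e₁ (window w top h) (h * d) m A B top)) (sym (e₂ A B top h))
      (+-monoʳ-< (suc top * B) (final top h top+h≡n)))
    where
    h = n ∸ top
    top+h≡n : top + h ≡ n
    top+h≡n = m+[n∸m]≡n top≤n
    e₁ : ∀ s t m A B i → (s + t + (m + 0)) * A + suc i * B ≡ suc i * B + (m + s + t) * A
    e₁ = solve-∀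
    e₂ : ∀ A B i h → A + (i + h + 2) * B ≡ suc i * B + (suc h * B + A)
    e₂ = solve-∀

windowBounds⇒rowBounds : ∀ {A B m d w} → WindowBounds A B d w →
  (∀ i h → i + h ≡ length w → BelowSlope A B (suc h) (m + window w i h + h * d)) →
  ∃[ N ] RowBounds A B N m d w
windowBounds⇒rowBounds {A} {B} {m} {d} {w} bounds final =
  rowValue A B m d w top , windowBounds⇒rowBounds-at bounds final top
    (s≤s⁻¹ (argmax-all (rowValue A B m d w) (s≤s z≤n) (All.tabulate ∈-upTo⁻)))
    (λ i i≤ → All.lookup (f[xs]≤f[argmax] {f = rowValue A B m d w} 0 (upTo (suc (length w)))) (∈-upTo⁺ (s≤s i≤)))
  where
  top = argmax (rowValue A B m d w) 0 (upTo (suc (length w)))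

All-minPart : ∀ {P : ℕ → Set} τ → All P τ → 1 ≤ length τ → P (minPart τ)
All-minPart (x ∷ [])    (p ∷ _)  _ = p
All-minPart (x ∷ y ∷ τ) (_ ∷ ps) _ = All-minPart (y ∷ τ) ps (s≤s z≤n)

0∈wrd : ∀ τ → 2 ≤ length τ → 0 ∈ wrd τ
0∈wrd (x ∷ [])       (s≤s ())
0∈wrd τ@(x ∷ y ∷ τ′) _ =
  subst (_∈ wrd τ) (n∸n≡0 (dif τ)) (∈-map⁺ (_∸ dif τ) (minList-∈ (x ∸ y) (diffs (y ∷ τ′))))

windowBounds-·1 : ∀ {A B d w} → 1 ≤ A → B < (d + 1) * A → WindowBounds A B d w →
  (∀ i h → i + h ≡ length w → BelowSlope A B (suc h) (d + 1 + window w i h + h * d)) →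
  WindowBounds A B d (w ·1)
windowBounds-·1 {A} {B} {d} {w} 1≤A B<[d+1]A bounds final i h i+h≤ with i + h ≤? length w
... | yes i+h≤w = subst (λ s → BelowSlope A B h (s + h * d) × AboveSlope A B h (s + h * d))
                        (sym (window-++ w (1 ∷ []) i h i+h≤w)) (bounds i h i+h≤w)
windowBounds-·1 {B = B} 1≤A _ _ _ i zero _ | no _ = zero-slopes B 1≤A
windowBounds-·1 {A} {B} {d} {w} 1≤A B<[d+1]A bounds final i (suc h) i+h≤ | no i+h≰w =
  subst (λ t → BelowSlope A B (suc h) (t + suc h * d) × AboveSlope A B (suc h) (t + suc h * d))
        (sym (window-·1 w i h i+h≡))
        ( subst (_< suc h * B + A) (e₁ s h d A) (final i h i+h≡)
        , subst₂ _<_ (e₂ h B) (e₃ s h d A) (+-mono-< B<[d+1]A (proj₂ (bounds i h (≤-reflexive i+h≡)))))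
  where
  s = window w i h
  i+h≡ : i + h ≡ length w
  i+h≡ = suc-injective (trans (sym (+-suc i h)) (≤-antisym
    (subst (i + suc h ≤_) (trans (length-++ w) (+-comm (length w) 1)) i+h≤) (≰⇒> i+h≰w)))
  e₁ : ∀ s h d A → (d + 1 + s + h * d) * A ≡ (s + 1 + suc h * d) * A
  e₁ = solve-∀
  e₂ : ∀ h B → B + h * B ≡ suc h * B
  e₂ = solve-∀
  e₃ : ∀ s h d A → (d + 1) * A + (s + h * d + 1) * A ≡ (s + 1 + suc h * d + 1) * A
  e₃ = solve-∀

integerCut⇒InT : ∀ {A B N m d w} → 1 ≤ m → 0 ∈ w → 1 ≤ A → A < B → IntegerCut A B N (ξ′ m d w) → InT (m , d , w)
integerCut⇒InT {A} {B} {N} {m} {d} {w} 1≤m 0∈w 1≤A A<B cut =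
  1≤m , 1≤d , (balanced⇒binary balanced 0∈w , balanced , 0∈w) , m≤d+1 , w·1∈B⁰
  where
  rows = integerCut⇒rowBounds 1≤m cut
  windows = rowBounds⇒windowBounds rows
  balanced = windowBounds⇒balanced windows
  B<[d+1]A : B < (d + 1) * A
  B<[d+1]A with ∈⇒window w 0∈w
  ... | j , j+1≤ , window≡0 = subst₂ _<_ (*-identityˡ B) (trans (cong (λ s → (s + 1 * d + 1) * A) window≡0) (e d A))
                                (proj₂ (windows j 1 j+1≤))
    where e : ∀ d A → (0 + 0 + 1 * d + 1) * A ≡ (d + 1) * A
          e = solve-∀
  1≤d : 1 ≤ d
  1≤d = +-cancelʳ-≤ 1 1 d (*-cancelʳ-< A 1 (d + 1) (subst (_< (d + 1) * A) (sym (+-identityʳ A)) (<-trans A<B B<[d+1]A)))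
  m≤d+1 : m ≤ d + 1
  m≤d+1 = s≤s⁻¹ (*-cancelʳ-< A m (suc (d + 1)) (<-trans m*A<A+B (subst (A + B <_) (e₃ d A) (+-monoʳ-< A B<[d+1]A))))
    where
    e₁ : ∀ m d A → (m + 0 + 0 * d) * A ≡ m * A
    e₁ = solve-∀
    e₂ : ∀ A B → 1 * B + A ≡ A + B
    e₂ = solve-∀
    e₃ : ∀ d A → A + (d + 1) * A ≡ suc (d + 1) * A
    e₃ = solve-∀
    m*A<A+B : m * A < A + B
    m*A<A+B = subst₂ _<_ (e₁ m d A) (e₂ A B) (rowBounds⇒finalWindow rows (length w) 0 (+-identityʳ _))
  w·1∈B⁰ : m ≡ d + 1 → InB⁰ (w ·1)
  w·1∈B⁰ m≡d+1 = ++⁺ (balanced⇒binary balanced 0∈w) (≤-refl ∷ []) ,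
    windowBounds⇒balanced (windowBounds-·1 1≤A B<[d+1]A windows λ i h i+h≡ →
      subst (λ m → BelowSlope A B (suc h) (m + window w i h + h * d)) m≡d+1 (rowBounds⇒finalWindow rows i h i+h≡)) ,
    ∈-++⁺ˡ 0∈w

χ∈T : ∀ τ → InΩ' τ → InT (χ τ)
χ∈T τ ((positive , decreasing) , _ , wide , 2≤k) with wide⇒integerCut {τ} wide
... | A , B , N , 1≤A , A<B , cut =
  integerCut⇒InT (All-minPart τ positive (≤-trans (s≤s z≤n) 2≤k)) (0∈wrd τ 2≤k) 1≤A A<B
    (subst (IntegerCut A B N) (sym (ξ′-χ τ (positive , decreasing) 2≤k)) cut)

-- A slope constraint (k , p) concerns a window of length suc k with value p.
-- Crosses says (p − 1) / (k + 1) < (p′ + 1) / (K + 1): the lower bound on B / A imposed by the first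
-- lies below the upper bound imposed by the second.
Constraint : Set
Constraint = ℕ × ℕ

Crosses : Constraint → Constraint → Set
Crosses (k , p) (K , p′) = suc K * p < suc k * (p′ + 1) + suc K

floorSlope : ℕ → Constraint → ℕ
floorSlope A (k , p) = (p ∸ 1) * A / suc k

floorSlope≤⇒below : ∀ A k p {G} → floorSlope A (k , p) ≤ G → BelowSlope A (suc G) (suc k) p
floorSlope≤⇒below A k p {G} le = ≤-<-trans p*A≤ (+-monoˡ-< A [p∸1]*A<)
  where
  open ≤-Reasoning
  [p∸1]*A< : (p ∸ 1) * A < suc k * suc G
  [p∸1]*A< = begin-strict
    (p ∸ 1) * A                                           ≡⟨ m≡m%n+[m/n]*n ((p ∸ 1) * A) (suc k) ⟩
    (p ∸ 1) * A % suc k + floorSlope A (k , p) * suc k   <⟨ +-monoˡ-< _ (m%n<n ((p ∸ 1) * A) (suc k)) ⟩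
    suc k + floorSlope A (k , p) * suc k                 ≤⟨ +-monoʳ-≤ (suc k) (*-monoˡ-≤ (suc k) le) ⟩
    suc k + G * suc k                                     ≡⟨ *-comm (suc G) (suc k) ⟩
    suc k * suc G                                         ∎
  p*A≤ : p * A ≤ (p ∸ 1) * A + A
  p*A≤ = begin
    p * A             ≤⟨ *-monoˡ-≤ A (m≤n+m∸n p 1) ⟩
    (1 + (p ∸ 1)) * A ≡⟨ e (p ∸ 1) A ⟩
    (p ∸ 1) * A + A   ∎
    where e : ∀ x A → (1 + x) * A ≡ x * A + A
          e = solve-∀

crosses-∸ : ∀ k p K p′ → Crosses (k , p) (K , p′) → suc K * (p ∸ 1) + 1 ≤ suc k * (p′ + 1)
crosses-∸ k zero    K p′ _ = subst (_≤ suc k * (p′ + 1)) (sym (cong (_+ 1) (*-zeroʳ (suc K))))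
                               (*-mono-≤ {1} {suc k} (s≤s z≤n) (m≤n+m 1 p′))
crosses-∸ k (suc p) K p′ cross = subst (_≤ suc k * (p′ + 1)) (+-comm 1 (suc K * p))
  (+-cancelʳ-< (suc K) (suc K * p) (suc k * (p′ + 1)) (subst (_< suc k * (p′ + 1) + suc K) (e (suc K) p) cross))
  where e : ∀ Q p → Q * suc p ≡ Q * p + Q
        e = solve-∀

≤floorSlope⇒above : ∀ A k p K p′ {G} → G ≤ floorSlope A (k , p) → suc k * suc K < A →
                    Crosses (k , p) (K , p′) → AboveSlope A (suc G) (suc K) p′
≤floorSlope⇒above A k p K p′ {G} le qQ<A cross = *-cancelˡ-< q (Q * suc G) ((p′ + 1) * A) (begin-strict
  q * (Q * suc G)           ≡⟨ e₁ q Q G ⟩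
  Q * (G * q) + q * Q       ≤⟨ +-monoˡ-≤ (q * Q) (*-monoʳ-≤ Q G*q≤) ⟩
  Q * (P * A) + q * Q       <⟨ +-monoʳ-< (Q * (P * A)) qQ<A ⟩
  Q * (P * A) + A           ≡⟨ e₂ Q P A ⟩
  (Q * P + 1) * A           ≤⟨ *-monoˡ-≤ A (crosses-∸ k p K p′ cross) ⟩
  q * (p′ + 1) * A          ≡⟨ *-assoc q (p′ + 1) A ⟩
  q * ((p′ + 1) * A)        ∎)
  where
  open ≤-Reasoning
  q = suc k
  Q = suc K
  P = p ∸ 1
  G*q≤ : G * q ≤ P * A
  G*q≤ = ≤-trans (*-monoˡ-≤ q le) (m/n*n≤m (P * A) q)
  e₁ : ∀ q Q G → q * (Q * suc G) ≡ Q * (G * q) + q * Q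
  e₁ = solve-∀
  e₂ : ∀ Q P A → Q * (P * A) + A ≡ (Q * P + 1) * A
  e₂ = solve-∀

-- The slope B / A is chosen just above the steepest lower constraint; every upper constraint
-- survives because it crosses that steepest one.
slope-between : ∀ A c₀ (lows ups : List Constraint) → c₀ ∈ lows →
  (∀ {lo up} → lo ∈ lows → up ∈ ups → Crosses lo up) →
  (∀ {k p K p′} → (k , p) ∈ lows → (K , p′) ∈ ups → suc k * suc K < A) →
  ∃[ B ] (∀ {k p} → (k , p) ∈ lows → BelowSlope A B (suc k) p)
       × (∀ {K p′} → (K , p′) ∈ ups → AboveSlope A B (suc K) p′)
slope-between A c₀ lows ups c₀∈ cross small = suc (floorSlope A steepest) , below , above
  where
  steepest = argmax (floorSlope A) c₀ lows
  steepest∈ : steepest ∈ lows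
  steepest∈ with argmax-sel (floorSlope A) c₀ lows
  ... | inj₁ ≡⊥ = subst (_∈ lows) (sym ≡⊥) c₀∈
  ... | inj₂ ∈lows = ∈lows
  below : ∀ {k p} → (k , p) ∈ lows → BelowSlope A (suc (floorSlope A steepest)) (suc k) p
  below {k} {p} c∈lows = floorSlope≤⇒below A k p (All.lookup (f[xs]≤f[argmax] c₀ lows) c∈lows)
  above : ∀ {K p′} → (K , p′) ∈ ups → AboveSlope A (suc (floorSlope A steepest)) (suc K) p′
  above {K} {p′} c∈ups = ≤floorSlope⇒above A (proj₁ steepest) (proj₂ steepest) K p′ ≤-refl
    (small steepest∈ c∈ups) (cross steepest∈ c∈ups)

windowConstraint : ℕ → List ℕ → ℕ → ℕ → Constraint
windowConstraint d w i k = k , window w i (suc k) + suc k * d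

windowConstraintsAt : ℕ → List ℕ → ℕ → List Constraint
windowConstraintsAt d w i = map (windowConstraint d w i) (upTo (length w ∸ i))

windowConstraints : ℕ → List ℕ → List Constraint
windowConstraints d w = concatMap (windowConstraintsAt d w) (upTo (length w))

∈-windowConstraints⁺ : ∀ {d w i k} → i + suc k ≤ length w → windowConstraint d w i k ∈ windowConstraints d w
∈-windowConstraints⁺ {d} {w} {i} {k} i+k<n =
  ∈-concatMap⁺ (windowConstraintsAt d w) (lose (∈-upTo⁺ i<n) (∈-map⁺ (windowConstraint d w i) (∈-upTo⁺ k<n∸i)))
  where
  i<n : i < length w
  i<n = ≤-trans (m≤m+n (suc i) k) (subst (_≤ length w) (+-suc i k) i+k<n)
  k<n∸i : k < length w ∸ i
  k<n∸i = subst (_≤ length w ∸ i) (m+n∸m≡n i (suc k)) (∸-monoˡ-≤ i i+k<n)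

∈-windowConstraints⁻ : ∀ {d w c} → c ∈ windowConstraints d w →
                       ∃[ i ] ∃[ k ] i + suc k ≤ length w × c ≡ windowConstraint d w i k
∈-windowConstraints⁻ {d} {w} c∈ with find (∈-concatMap⁻ (windowConstraintsAt d w) c∈)
... | i , i∈ , c∈map with ∈-map⁻ (windowConstraint d w i) c∈map
...   | k , k∈ , c≡ = i , k , subst (i + suc k ≤_) (m+[n∸m]≡n (<⇒≤ (∈-upTo⁻ i∈))) (+-monoʳ-≤ i (∈-upTo⁻ k∈)) , c≡

-- The window from i to the end of w, extended by the last part m; these keep row length w + 2 empty.
endConstraint : ℕ → ℕ → List ℕ → ℕ → Constraint
endConstraint m d w i = length w ∸ i , m + window w i (length w ∸ i) + (length w ∸ i) * d

endConstraints : ℕ → ℕ → List ℕ → List Constraint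
endConstraints m d w = map (endConstraint m d w) (upTo (suc (length w)))

balanced⇒crosses : ∀ {d v i k j K} → Balanced v → i + suc k ≤ length v → j + suc K ≤ length v →
                   Crosses (windowConstraint d v i k) (windowConstraint d v j K)
balanced⇒crosses {d} {v} {i} {k} {j} {K} bal i+k< j+K< =
  subst₂ _<_ (sym (e₁ (suc K) s (suc k) d)) (sym (e₂ (suc K) s′ (suc k) d))
    (+-monoˡ-< (suc k * suc K * d) (balanced-cross bal i (suc k) j (suc K) (s≤s z≤n) i+k< j+K<))
  where
  s = window v i (suc k)
  s′ = window v j (suc K)
  e₁ : ∀ Q s H d → Q * (s + H * d) ≡ Q * s + H * Q * d
  e₁ = solve-∀
  e₂ : ∀ Q s′ H d → H * (s′ + Q * d + 1) + Q ≡ H * (s′ + 1) + Q + H * Q * d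
  e₂ = solve-∀

base-crosses : ∀ {d} w j K → 1 ≤ d → Crosses (0 , 2) (windowConstraint d w j K)
base-crosses {d} w j K 1≤d = subst₂ _<_ (e₁ (suc K)) (e₂ p′ (suc K)) (s≤s (+-monoˡ-≤ (suc K) Q≤p′))
  where
  p′ = window w j (suc K) + suc K * d
  Q≤p′ : suc K ≤ p′
  Q≤p′ = ≤-trans (subst (_≤ suc K * d) (*-identityʳ (suc K)) (*-monoʳ-≤ (suc K) 1≤d)) (m≤n+m (suc K * d) (window w j (suc K)))
  e₁ : ∀ Q → Q + Q ≡ Q * 2
  e₁ = solve-∀
  e₂ : ∀ p′ Q → suc (p′ + Q) ≡ 1 * (p′ + 1) + Q
  e₂ = solve-∀

InT⇒end-crosses : ∀ {m d w i j K} → InT (m , d , w) → i ≤ length w → j + suc K ≤ length w →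
                  Crosses (endConstraint m d w i) (windowConstraint d w j K)
InT⇒end-crosses {m} {d} {w} {i} {j} {K} (_ , _ , (_ , bal , _) , m≤d+1 , w·1∈B⁰) i≤ j+K< with m≤n⇒m<n∨m≡n m≤d+1
... | inj₁ m<d+1 = ≤-<-trans (*-monoʳ-≤ Q (+-monoˡ-≤ (h * d) (+-monoˡ-≤ s (s≤s⁻¹ (subst (suc m ≤_) (+-comm d 1) m<d+1)))))
    (subst₂ _<_ (sym (e₁ Q s h d)) (sym (e₂ Q s′ h d))
      (<-≤-trans (+-monoˡ-< (Q * suc h * d) (balanced-cross bal i h j Q (s≤s z≤n) (≤-reflexive (m+[n∸m]≡n i≤)) j+K<))
                 (m≤m+n _ (s′ + 1))))
  where
  Q = suc K
  h = length w ∸ i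
  s = window w i h
  s′ = window w j Q
  e₁ : ∀ Q s h d → Q * (d + s + h * d) ≡ Q * s + Q * suc h * d
  e₁ = solve-∀
  e₂ : ∀ Q s′ h d → suc h * (s′ + Q * d + 1) + Q ≡ h * (s′ + 1) + Q + Q * suc h * d + (s′ + 1)
  e₂ = solve-∀
... | inj₂ m≡d+1 = subst₂ _<_ (sym (trans (cong (λ m → Q * (m + s + h * d)) m≡d+1) (e₁ Q s h d))) (sym (e₂ Q s′ h d))
    (+-monoˡ-< (Q * suc h * d) cross·1)
  where
  Q = suc K
  h = length w ∸ i
  s = window w i h
  s′ = window w j Q
  i+h≡n : i + h ≡ length w
  i+h≡n = m+[n∸m]≡n i≤
  |w·1|≡ : length (w ·1) ≡ length w + 1
  |w·1|≡ = length-++ w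
  cross·1 : Q * (s + 1) < suc h * (s′ + 1) + Q
  cross·1 = subst₂ (λ a b → Q * a < suc h * (b + 1) + Q) (window-·1 w i h i+h≡n) (window-++ w (1 ∷ []) j Q j+K<)
    (balanced-cross (proj₁ (proj₂ (w·1∈B⁰ m≡d+1))) i (suc h) j Q (s≤s z≤n)
      (subst (i + suc h ≤_) (sym |w·1|≡) (≤-reflexive (trans (+-suc i h) (trans (cong suc i+h≡n) (+-comm 1 (length w))))))
      (subst (j + Q ≤_) (sym |w·1|≡) (≤-trans j+K< (m≤m+n (length w) 1))))
  e₁ : ∀ Q s h d → Q * (d + 1 + s + h * d) ≡ Q * (s + 1) + Q * suc h * d
  e₁ = solve-∀
  e₂ : ∀ Q s′ h d → suc h * (s′ + Q * d + 1) + Q ≡ suc h * (s′ + 1) + Q + Q * suc h * d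
  e₂ = solve-∀

-- (0 , 2) says 2 A < B + A, i.e. the cutting line is wide.
lowerConstraints : ℕ → ℕ → List ℕ → List Constraint
lowerConstraints m d w = (0 , 2) ∷ windowConstraints d w ++ endConstraints m d w

data LowerConstraint (m d : ℕ) (w : List ℕ) : Constraint → Set where
  base   : LowerConstraint m d w (0 , 2)
  inner  : ∀ {i k} → i + suc k ≤ length w → LowerConstraint m d w (windowConstraint d w i k)
  ending : ∀ {i} → i ≤ length w → LowerConstraint m d w (endConstraint m d w i)

∈-lowerConstraints⁻ : ∀ {m d w c} → c ∈ lowerConstraints m d w → LowerConstraint m d w c
∈-lowerConstraints⁻ (here refl) = base
∈-lowerConstraints⁻ {m} {d} {w} (there c∈) with ∈-++⁻ (windowConstraints d w) c∈
... | inj₁ c∈windows with ∈-windowConstraints⁻ {d} {w} c∈windows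
...   | i , k , i+k< , c≡ = subst (LowerConstraint m d w) (sym c≡) (inner i+k<)
∈-lowerConstraints⁻ {m} {d} {w} (there c∈) | inj₂ c∈ends with ∈-map⁻ (endConstraint m d w) c∈ends
...   | i , i∈ , c≡ = subst (LowerConstraint m d w) (sym c≡) (ending (s≤s⁻¹ (∈-upTo⁻ i∈)))

lowerConstraint-crosses : ∀ {m d w c j K} → InT (m , d , w) → j + suc K ≤ length w →
                          LowerConstraint m d w c → Crosses c (windowConstraint d w j K)
lowerConstraint-crosses {w = w} {j = j} (_ , 1≤d , _) _ base = base-crosses w j _ 1≤d
lowerConstraint-crosses (_ , _ , (_ , bal , _) , _) j+K< (inner i+k<) = balanced⇒crosses bal i+k< j+K<
lowerConstraint-crosses t∈T j+K< (ending i≤) = InT⇒end-crosses t∈T i≤ j+K<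

lowerConstraint-short : ∀ {m d w k p} → LowerConstraint m d w (k , p) → suc k ≤ length w + 1
lowerConstraint-short base = m≤n+m 1 _
lowerConstraint-short {w = w} (inner {i} {k} i+k<) = ≤-trans (m+n≤o⇒n≤o i i+k<) (m≤m+n (length w) 1)
lowerConstraint-short {w = w} (ending {i} _) = subst (suc (length w ∸ i) ≤_) (+-comm 1 (length w)) (s≤s (m∸n≤m (length w) i))

slopes⇒integerCut : ∀ {A B m d w} → 1 ≤ A →
  (∀ {k p} → (k , p) ∈ lowerConstraints m d w → BelowSlope A B (suc k) p) →
  (∀ {K p′} → (K , p′) ∈ windowConstraints d w → AboveSlope A B (suc K) p′) →
  A < B × ∃[ N ] 1 ≤ N × IntegerCut A B N (ξ′ m d w)
slopes⇒integerCut {A} {B} {m} {d} {w} 1≤A below above = A<B , N , 1≤N , rowBounds⇒integerCut rows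
  where
  windows : WindowBounds A B d w
  windows i zero    _     = zero-slopes B 1≤A
  windows i (suc k) i+k< = below (there (∈-++⁺ˡ (∈-windowConstraints⁺ i+k<))) , above (∈-windowConstraints⁺ i+k<)
  final : ∀ i h → i + h ≡ length w → BelowSlope A B (suc h) (m + window w i h + h * d)
  final i h i+h≡n = subst (λ h → BelowSlope A B (suc h) (m + window w i h + h * d)) n∸i≡h
    (below (there (∈-++⁺ʳ (windowConstraints d w) (∈-map⁺ (endConstraint m d w) (∈-upTo⁺ i<n+1)))))
    where
    n∸i≡h : length w ∸ i ≡ h
    n∸i≡h = trans (cong (_∸ i) (sym i+h≡n)) (m+n∸m≡n i h)
    i<n+1 : i < suc (length w)
    i<n+1 = s≤s (m+n≤o⇒m≤o i (≤-reflexive i+h≡n))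
  N = proj₁ (windowBounds⇒rowBounds {A} {B} {m} {d} {w} windows final)
  rows : RowBounds A B N m d w
  rows = proj₂ (windowBounds⇒rowBounds windows final)
  A<B : A < B
  A<B = +-cancelʳ-< A A B (subst₂ _<_ (e₁ A) (e₂ B A) (below (here refl)))
    where
    e₁ : ∀ A → 2 * A ≡ A + A
    e₁ = solve-∀
    e₂ : ∀ B A → 1 * B + A ≡ B + A
    e₂ = solve-∀
  1≤N : 1 ≤ N
  1≤N = ≤-trans (subst (1 ≤_) (sym (*-identityˡ B)) (≤-trans 1≤A (<⇒≤ A<B)))
                (≤-trans (m≤n+m (1 * B) (ξ-part m d w 0 * A)) (RowBounds.row≤ rows 0 z≤n))


InT⇒integerCut : ∀ {m d w} → InT (m , d , w) →
                 ∃[ A ] ∃[ B ] ∃[ N ] 1 ≤ A × A < B × 1 ≤ N × IntegerCut A B N (ξ′ m d w)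
InT⇒integerCut {m} {d} {w} t∈T = A , B , N , s≤s z≤n , A<B , 1≤N , cut
  where
  n = length w
  -- A exceeds every product of two window lengths, which are at most n + 1.
  A = suc ((n + 1) * (n + 1))
  crosses : ∀ {lo up} → LowerConstraint m d w lo → ∃[ j ] ∃[ K ] j + suc K ≤ n × up ≡ windowConstraint d w j K →
            Crosses lo up
  crosses lo (j , K , j+K< , refl) = lowerConstraint-crosses t∈T j+K< lo
  short : ∀ {k K p′} → suc k ≤ n + 1 → ∃[ j ] ∃[ K′ ] j + suc K′ ≤ n × (K , p′) ≡ windowConstraint d w j K′ →
          suc k * suc K < A
  short q≤ (j , K′ , j+K< , refl) = s≤s (*-mono-≤ q≤ (≤-trans (m+n≤o⇒n≤o j j+K<) (m≤m+n n 1)))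
  slope = slope-between A (0 , 2) (lowerConstraints m d w) (windowConstraints d w) (here refl)
    (λ lo∈ up∈ → crosses (∈-lowerConstraints⁻ lo∈) (∈-windowConstraints⁻ {d} {w} up∈))
    (λ lo∈ up∈ → short (lowerConstraint-short (∈-lowerConstraints⁻ lo∈)) (∈-windowConstraints⁻ {d} {w} up∈))
  B = proj₁ slope
  cutAtSlope = slopes⇒integerCut {A} {B} {m} {d} {w} (s≤s z≤n) (proj₁ (proj₂ slope)) (proj₂ (proj₂ slope))
  A<B = proj₁ cutAtSlope
  N = proj₁ (proj₂ cutAtSlope)
  1≤N = proj₁ (proj₂ (proj₂ cutAtSlope))
  cut = proj₂ (proj₂ (proj₂ cutAtSlope))

ξ′-bounded : ∀ m d w → All (m ≤_) (ξ′ m d w)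
ξ′-bounded m d []      = m≤m+n m _ ∷ All.[]
ξ′-bounded m d (x ∷ w) = m≤m+n m _ ∷ ξ′-bounded m d w

ξ′-decreasing : ∀ m d w → Decreasing (ξ′ m d w)
ξ′-decreasing m d []          = [-]
ξ′-decreasing m d (x ∷ [])    = ξ-part-≤-∷ m d x [] ∷ [-]
ξ′-decreasing m d (x ∷ y ∷ w) = ξ-part-≤-∷ m d x (y ∷ w) ∷ ξ′-decreasing m d (y ∷ w)

wide⇒triangular : ∀ {τ} → Wide τ → Triangular τ
wide⇒triangular (r , s , cut , _) = r , s , cut

ξ′∈Ω′ : ∀ {m d w} → InT (m , d , w) → InΩ' (ξ′ m d w)
ξ′∈Ω′ {m} {d} {w} t∈T@(1≤m , _ , (_ , _ , 0∈w) , _) = fromCut (InT⇒integerCut t∈T)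
  where
  nonempty : ∀ {x : ℕ} {l} → x ∈ l → 1 ≤ length l
  nonempty {l = _ ∷ _} _ = s≤s z≤n
  fromCut : ∃[ A ] ∃[ B ] ∃[ N ] 1 ≤ A × A < B × 1 ≤ N × IntegerCut A B N (ξ′ m d w) → InΩ' (ξ′ m d w)
  fromCut (A , B , N , 1≤A , A<B , 1≤N , cut) =
    (All.map (≤-trans 1≤m) (ξ′-bounded m d w) , ξ′-decreasing m d w) ,
    wide⇒triangular {ξ′ m d w} wide , wide , subst (2 ≤_) (sym (length-ξ′ m d w)) (+-monoˡ-≤ 1 (nonempty 0∈w))
    where
    wide : Wide (ξ′ m d w)
    wide = integerCut⇒wide {ξ′ m d w} 1≤A A<B 1≤N cut

ξ-χ : ∀ τ → InΩ' τ → ξ (χ τ) ≡ τ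
ξ-χ τ (partition , _ , _ , 2≤k) = trans (ξ≡ξ′ _ _ _) (ξ′-χ τ partition 2≤k)

ξ∈Ω′ : ∀ t → InT t → InΩ' (ξ t)
ξ∈Ω′ (m , d , w) t∈T = subst InΩ' (sym (ξ≡ξ′ m d w)) (ξ′∈Ω′ t∈T)

χ-ξ : ∀ t → InT t → χ (ξ t) ≡ t
χ-ξ (m , d , w) (_ , _ , (_ , _ , 0∈w) , _) = trans (cong χ (ξ≡ξ′ m d w)) (χ-ξ′ m d w 0∈w)

length-size-χ : ∀ τ → InΩ' τ → ∀ m d w → χ τ ≡ (m , d , w) →
                (length τ ≡ length w + 1) × (size τ ≡ length τ * m + (length τ C 2) * d + weightedSum w)
length-size-χ τ τ∈Ω′ m d w χτ≡ =
  subst (λ τ → (length τ ≡ length w + 1) × (size τ ≡ length τ * m + (length τ C 2) * d + weightedSum w)) ξ′≡τ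
    (length-ξ′ m d w , trans (size-ξ′ m d w) (cong (λ k → k * m + (k C 2) * d + weightedSum w) (sym (length-ξ′ m d w))))
  where
  ξ′≡τ : ξ′ m d w ≡ τ
  ξ′≡τ = trans (sym (ξ≡ξ′ m d w)) (trans (cong ξ (sym χτ≡)) (ξ-χ τ τ∈Ω′))

theorem5p9 :
    ((τ : List ℕ) → InΩ' τ → InT (χ τ))
    × ((t : Triple) → InT t → InΩ' (ξ t))
    × ((τ : List ℕ) → InΩ' τ → ξ (χ τ) ≡ τ)
    × ((t : Triple) → InT t → χ (ξ t) ≡ t)
    × ((τ : List ℕ) → InΩ' τ → (m d : ℕ) → (w : List ℕ) → χ τ ≡ (m , d , w) →
        (length τ ≡ length w + 1)
        × (size τ ≡ length τ * m + (length τ C 2) * d + weightedSum w))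
theorem5p9 = χ∈T , ξ∈Ω′ , ξ-χ , χ-ξ , length-size-χ
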